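{- If $G$ is a finite, simple, connected graph of order $n(G)\geq 3$, then $2\gamma_{r2}(G)+\gamma_R(G)\leq \frac{9}{4}n(G)$.
   Context: A $2$-rainbow dominating function of a graph $G$ is a function $f:V(G)\to 2^{\{1,2\}}$ such that $\bigcup_{v\in N_G(u)}f(v)=\{1,2\}$ for every vertex $u$ with $f(u)=\emptyset$; its weight is $\sum_{u\in V(G)}|f(u)|$, and $\gamma_{r2}(G)$ is the minimum weight of such a function. A Roman dominating function of $G$ is a function $g:V(G)\to\{0,1,2\}$ such that every vertex $u$ with $g(u)=0$ has a neighbor $v$ with $g(v)=2$; its weight is $\sum_{u\in V(G)}g(u)$, and $\gamma_R(G)$ is the minimum weight of such a function. -}

module Defs where

open import Data.Nat using (ℕ; _+_; _≤_)
open import Data.Bool using (Bool; true; false; _∧_; _∨_)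
open import Data.Fin using (Fin)
open import Data.List using (List; map; allFin)
open import Data.Nat.ListAction using (sum)
open import Data.Product using (Σ; ∃; _×_; _,_; proj₁; proj₂)
open import Relation.Binary.PropositionalEquality using (_≡_; _≢_)
open import Relation.Nullary using (¬_)

record Graph (n : ℕ) : Set where
  field
    adj    : Fin n → Fin n → Bool
    sym    : ∀ u v → adj u v ≡ adj v u
    irrefl : ∀ v → adj v v ≡ false
open Graph public

data Walk {n : ℕ} (G : Graph n) : Fin n → Fin n → Set where
  here : ∀ {v} → Walk G v v
  step : ∀ {u w v} → adj G u w ≡ true → Walk G w v → Walk G u v

Connected : ∀ {n} → Graph n → Set
Connected {n} G = ∀ (u v : Fin n) → Walk G u v

vsum : ∀ {n} → (Fin n → ℕ) → ℕ
vsum {n} f = sum (map f (allFin n))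

-- Subsets of {1,2}: (1 ∈ S , 2 ∈ S).
Sub12 : Set
Sub12 = Bool × Bool

b2n : Bool → ℕ
b2n true  = 1
b2n false = 0

card12 : Sub12 → ℕ
card12 (a , b) = b2n a + b2n b

IsEmpty12 : Sub12 → Set
IsEmpty12 (a , b) = (a ≡ false) × (b ≡ false)

-- 2-rainbow dominating function: every u with f u = ∅ has neighbours
-- whose labels together cover {1,2}, i.e. some neighbour contains 1 and
-- some neighbour contains 2.
IsRainbow2DF : ∀ {n} → Graph n → (Fin n → Sub12) → Set
IsRainbow2DF {n} G f =
  ∀ (u : Fin n) → IsEmpty12 (f u) →
    (∃ λ v → (adj G u v ≡ true) × (proj₁ (f v) ≡ true)) ×
    (∃ λ w → (adj G u w ≡ true) × (proj₂ (f w) ≡ true))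

weightR2 : ∀ {n} → (Fin n → Sub12) → ℕ
weightR2 f = vsum (λ u → card12 (f u))

IsGammaR2 : ∀ {n} → Graph n → ℕ → Set
IsGammaR2 {n} G k =
  (Σ (Fin n → Sub12) λ f → IsRainbow2DF G f × (weightR2 f ≡ k)) ×
  (∀ (f : Fin n → Sub12) → IsRainbow2DF G f → k ≤ weightR2 f)

IsRomanDF : ∀ {n} → Graph n → (Fin n → ℕ) → Set
IsRomanDF {n} G g =
  (∀ u → g u ≤ 2) ×
  (∀ (u : Fin n) → g u ≡ 0 → ∃ λ v → (adj G u v ≡ true) × (g v ≡ 2))

IsGammaR : ∀ {n} → Graph n → ℕ → Set
IsGammaR {n} G k =
  (Σ (Fin n → ℕ) λ g → IsRomanDF G g × (vsum g ≡ k)) ×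
  (∀ (g : Fin n → ℕ) → IsRomanDF G g → k ≤ vsum g)

module Submission where

-- Call a spider a centre with at least two legs, each leg being a
-- leaf or a path knee–foot.  Every connected graph on n ≥ 3 vertices has a
-- spanning forest of spiders (spiderCover): a path on three vertices is a
-- spider, and a vertex v adjacent to a covered vertex y can always be added
-- by rearranging the spider(s) around y (Growth.Step.addVertex, six cases).
-- On a complete spider cover, labelling centres {1,2} or {2}, feet {1} and
-- everything else ∅ is a 2-rainbow dominating function f, and labelling
-- centres 2, feet 1 and everything else 0 is a Roman dominating function g;
-- a discharging argument shows 8w(f) + 4w(g) ≤ 9n (CompleteCover).

open import Defs hiding (sym)
open import Data.Nat using (ℕ; zero; suc; _+_; _*_; _≤_; _<_; z≤n; s≤s)
open import Data.Nat.Induction using (<-wellFounded)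
open import Induction.WellFounded using (Acc; acc)
open import Data.Nat.Properties
  using (+-*-semiring; ≤-refl; ≤-trans; ≤-reflexive; +-mono-≤; +-monoʳ-≤;
         *-monoʳ-≤; m≤m+n; m≤n+m; +-cancelʳ-≤; *-comm; *-assoc;
         *-distribˡ-+; +-identityʳ; +-comm; +-suc; module ≤-Reasoning)
open import Data.Bool using (Bool; true; false; if_then_else_)
open import Data.Fin using (Fin; zero; suc; _≟_)
open import Data.Fin.Properties using (any?; suc-injective)
open import Data.List using (List; []; _∷_; tabulate)
open import Data.List.Relation.Unary.All using (All; []; _∷_; lookup)
open import Data.List.Relation.Unary.All.Properties using (¬Any⇒All¬; ++⁺)
open import Data.Vec.Functional using (updateAt)
open import Data.Vec.Functional.Properties using (updateAt-updates; updateAt-minimal)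
open import Data.List.Properties using (map-tabulate)
open import Data.Nat.ListAction using () renaming (sum to listSum)
open import Data.Product using (Σ; ∃; _×_; _,_; proj₁; proj₂)
open import Data.Sum using (_⊎_; inj₁; inj₂; [_,_])
import Data.Sum
open import Data.Empty using (⊥; ⊥-elim)
open import Function using (id; const; _$_)
open import Relation.Binary.PropositionalEquality
  using (_≡_; _≢_; refl; sym; trans; cong; cong₂; subst; subst₂)
open import Relation.Nullary using (Dec; yes; no; ¬_; does)
open import Relation.Nullary.Decidable using (_×-dec_; _⊎-dec_; ¬?; map′)
import Data.Bool.Properties as Bool
open import Algebra.Properties.Semiring.Sum +-*-semiring
  using (∑-distrib-+; ∑-comm; sum-cong-≗; sum-replicate-zero; *-distribˡ-sum)
  renaming (sum to ∑)

vsum≡∑ : ∀ {n} (f : Fin n → ℕ) → vsum f ≡ ∑ f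
vsum≡∑ f = trans (cong listSum (map-tabulate id f)) (sum-tabulate f)
  where
  sum-tabulate : ∀ {n} (f : Fin n → ℕ) → listSum (tabulate f) ≡ ∑ f
  sum-tabulate {zero}  f = refl
  sum-tabulate {suc n} f = cong (f zero +_) (sum-tabulate (λ i → f (suc i)))

∑-mono : ∀ {n} {f g : Fin n → ℕ} → (∀ x → f x ≤ g x) → ∑ f ≤ ∑ g
∑-mono {zero}  f≤g = z≤n
∑-mono {suc n} f≤g = +-mono-≤ (f≤g zero) (∑-mono (λ i → f≤g (suc i)))

∑-const : ∀ n k → ∑ {n} (const k) ≡ n * k
∑-const zero    k = refl
∑-const (suc n) k = cong (k +_) (∑-const n k)

∑-term : ∀ {n} (f : Fin n → ℕ) a → f a ≤ ∑ f
∑-term f zero    = m≤m+n (f zero) _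
∑-term f (suc a) = ≤-trans (∑-term (λ i → f (suc i)) a) (m≤n+m _ (f zero))

∑-terms : ∀ {n} (f : Fin n → ℕ) {a b} → a ≢ b → f a + f b ≤ ∑ f
∑-terms f {zero}  {zero}  a≢b = ⊥-elim (a≢b refl)
∑-terms f {zero}  {suc b} a≢b = +-monoʳ-≤ (f zero) (∑-term (λ i → f (suc i)) b)
∑-terms f {suc a} {zero}  a≢b = ≤-trans (≤-reflexive (+-comm (f (suc a)) (f zero)))
                                        (+-monoʳ-≤ (f zero) (∑-term (λ i → f (suc i)) a))
∑-terms f {suc a} {suc b} a≢b =
  ≤-trans (∑-terms (λ i → f (suc i)) (λ e → a≢b (cong suc e))) (m≤n+m _ (f zero))

point : ∀ {n} → Fin n → ℕ → Fin n → ℕ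
point a c y = if does (a ≟ y) then c else 0

point-at : ∀ {n} {a y : Fin n} c → a ≡ y → point a c y ≡ c
point-at {a = a} c refl with a ≟ a
... | yes _ = refl
... | no a≢a = ⊥-elim (a≢a refl)

∑-point : ∀ {n} (a : Fin n) c → ∑ (point a c) ≡ c
∑-point {suc n} zero    c = trans (cong (c +_) (sum-replicate-zero n)) (+-identityʳ c)
∑-point {suc n} (suc a) c = ∑-point a c

∑-decrease : ∀ {n} (f g : Fin n → ℕ) a → (∀ x → x ≢ a → g x ≡ f x) → g a < f a → ∑ g < ∑ f
∑-decrease f g zero    same ga<fa =
  +-mono-≤ ga<fa (≤-reflexive (sum-cong-≗ (λ i → same (suc i) λ ())))
∑-decrease f g (suc a) same ga<fa rewrite same zero (λ ()) =
  ≤-trans (≤-reflexive (sym (+-suc (f zero) _)))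
          (+-monoʳ-≤ (f zero) (∑-decrease (λ i → f (suc i)) (λ i → g (suc i)) a same′ ga<fa))
  where
  same′ : ∀ x → x ≢ a → g (suc x) ≡ f (suc x)
  same′ x x≢a = same (suc x) (λ e → x≢a (suc-injective e))

discharging : ∀ {n} (c : Fin n → ℕ) (h : Fin n → Fin n → ℕ) (b : ℕ) →
  (∀ x → c x + ∑ (h x) ≤ b + ∑ (λ y → h y x)) → ∑ c ≤ n * b
discharging {n} c h b balance = +-cancelʳ-≤ (∑ sent) (∑ c) (n * b) (begin
  ∑ c + ∑ sent                  ≡⟨ sym (∑-distrib-+ c sent) ⟩
  ∑ (λ x → c x + sent x)        ≤⟨ ∑-mono balance ⟩
  ∑ (λ x → b + received x)      ≡⟨ ∑-distrib-+ {n} (const b) received ⟩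
  ∑ {n} (const b) + ∑ received  ≡⟨ cong₂ _+_ (∑-const n b) (∑-comm (λ x y → h y x)) ⟩
  n * b + ∑ sent                ∎)
  where
  open ≤-Reasoning
  sent received : Fin n → ℕ
  sent x = ∑ (h x)
  received x = ∑ (λ y → h y x)

-- A partial spider cover records which
-- vertices are covered so far, the role of each covered vertex, its parent
-- (up: the centre of a leaf or knee, the knee of a foot) and, for a knee,
-- its foot (down).

data Role : Set where
  centre leaf knee foot : Role

isLeaf? : (r : Role) → Dec (r ≡ leaf)
isLeaf? centre = no λ ()
isLeaf? leaf   = yes refl
isLeaf? knee   = no λ ()
isLeaf? foot   = no λ ()

IsLeg : Role → Set
IsLeg r = (r ≡ leaf) ⊎ (r ≡ knee)

isLeg? : (r : Role) → Dec (IsLeg r)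
isLeg? r = isLeaf? r ⊎-dec isKnee? r
  where
  isKnee? : (r : Role) → Dec (r ≡ knee)
  isKnee? knee   = yes refl
  isKnee? centre = no λ ()
  isKnee? leaf   = no λ ()
  isKnee? foot   = no λ ()

record Spiders (n : ℕ) : Set where
  constructor spiders
  field
    inside : Fin n → Bool
    role   : Fin n → Role
    up     : Fin n → Fin n
    down   : Fin n → Fin n
open Spiders

record Leg {n} (s : Spiders n) (a x : Fin n) : Set where
  constructor leg
  field
    legInside : inside s a ≡ true
    legUp     : up s a ≡ x
    legShape  : IsLeg (role s a)

record TwoLegs {n} (s : Spiders n) (x : Fin n) : Set where
  constructor twoLegs
  field
    {leg₁ leg₂} : Fin n
    distinct    : leg₁ ≢ leg₂
    isLeg₁      : Leg s leg₁ x
    isLeg₂      : Leg s leg₂ x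

record HangsBelow {n} (G : Graph n) (s : Spiders n) (r : Role) (x : Fin n) : Set where
  constructor hangs
  field
    aboveInside : inside s (up s x) ≡ true
    aboveRole   : role s (up s x) ≡ r
    aboveAdj    : adj G x (up s x) ≡ true

record HasFoot {n} (s : Spiders n) (x : Fin n) : Set where
  constructor hasFoot
  field
    footInside : inside s (down s x) ≡ true
    footRole   : role s (down s x) ≡ foot
    footUp     : up s (down s x) ≡ x

module _ {n : ℕ} where

  Local : Graph n → Spiders n → Fin n → Role → Set
  Local G s x centre = TwoLegs s x
  Local G s x leaf   = HangsBelow G s centre x
  Local G s x knee   = HangsBelow G s centre x × HasFoot s x
  Local G s x foot   = HangsBelow G s knee x × (down s (up s x) ≡ x)

  Valid : Graph n → Spiders n → Set
  Valid G s = ∀ x → inside s x ≡ true → Local G s x (role s x)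

  local : ∀ {G s x r} → Valid G s → inside s x ≡ true → role s x ≡ r → Local G s x r
  local {G} {s} {x} I hx ρ = subst (Local G s x) ρ (I x hx)

  withRole : ∀ {G s x r} → role s x ≡ r → Local G s x r → Local G s x (role s x)
  withRole {G} {s} {x} ρ = subst (Local G s x) (sym ρ)

  hangsVia : ∀ {G : Graph n} {s : Spiders n} {x p : Fin n} {r : Role} → up s x ≡ p →
             inside s p ≡ true → role s p ≡ r → adj G x p ≡ true → HangsBelow G s r x
  hangsVia refl = hangs

  footVia : ∀ {s : Spiders n} {x f : Fin n} → down s x ≡ f → inside s f ≡ true → role s f ≡ foot →
            up s f ≡ x → HasFoot s x
  footVia refl = hasFoot

  leg? : ∀ (s : Spiders n) a x → Dec (Leg s a x)
  leg? s a x = map′ (λ (h , u , l) → leg h u l) (λ (leg h u l) → h , u , l)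
                    ((inside s a Bool.≟ true) ×-dec (up s a ≟ x) ×-dec isLeg? (role s a))

adjSym : ∀ {n} (G : Graph n) {u v} → adj G u v ≡ true → adj G v u ≡ true
adjSym G {u} {v} e = trans (Graph.sym G v u) e

-- f gives a centre {1,2} if it has a leaf and {2} otherwise, a foot {1},
-- and leaves and knees ∅; g gives centres 2, feet 1, and the rest 0.  The
-- cost 8|f(x)| + 4g(x) is 24 or 16 at a centre, 12 at a foot and 0
-- elsewhere; after every leaf passes 9 to its centre and every knee passes
-- 6 to its centre and 3 to its foot, no vertex holds more than 9.

module CompleteCover {n : ℕ} (G : Graph n) (s : Spiders n) (I : Valid G s)
                     (complete : ∀ x → inside s x ≡ true) where

  LeafOf : Fin n → Fin n → Set
  LeafOf c ℓ = (role s ℓ ≡ leaf) × (up s ℓ ≡ c)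

  hasLeaf? : ∀ c → Dec (∃ (LeafOf c))
  hasLeaf? c = any? (λ ℓ → isLeaf? (role s ℓ) ×-dec (up s ℓ ≟ c))

  centreLabel : ∀ {c} → Dec (∃ (LeafOf c)) → Sub12
  centreLabel (yes _) = (true , true)
  centreLabel (no _)  = (false , true)

  rainbowAt : Fin n → Role → Sub12
  rainbowAt x centre = centreLabel (hasLeaf? x)
  rainbowAt x leaf   = (false , false)
  rainbowAt x knee   = (false , false)
  rainbowAt x foot   = (true , false)

  rainbow : Fin n → Sub12
  rainbow x = rainbowAt x (role s x)

  romanAt : Role → ℕ
  romanAt centre = 2
  romanAt leaf   = 0
  romanAt knee   = 0
  romanAt foot   = 1

  roman : Fin n → ℕ
  roman x = romanAt (role s x)

  centreHas2 : ∀ c → role s c ≡ centre → proj₂ (rainbow c) ≡ true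
  centreHas2 c ρ rewrite ρ with hasLeaf? c
  ... | yes _ = refl
  ... | no _  = refl

  centreHas1 : ∀ c → role s c ≡ centre → ∃ (LeafOf c) → proj₁ (rainbow c) ≡ true
  centreHas1 c ρ ℓ rewrite ρ with hasLeaf? c
  ... | yes _  = refl
  ... | no ¬ℓ = ⊥-elim (¬ℓ ℓ)

  footHas1 : ∀ x → role s x ≡ foot → proj₁ (rainbow x) ≡ true
  footHas1 x ρ rewrite ρ = refl

  footAdj : ∀ u → role s u ≡ knee → adj G u (down s u) ≡ true
  footAdj u ρ with local I (complete u) ρ
  ... | _ , hasFoot _ ρo uo with local I (complete (down s u)) ρo
  ...   | hangs _ _ a , _ =
    adjSym G (subst (λ p → adj G (down s u) p ≡ true) uo a)

  rainbowValid : IsRainbow2DF G rainbow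
  rainbowValid u empty with role s u in ρ
  rainbowValid u empty | centre with hasLeaf? u
  rainbowValid u (() , _) | centre | yes _
  rainbowValid u (_ , ()) | centre | no _
  rainbowValid u (() , _) | foot
  rainbowValid u empty | leaf with local I (complete u) ρ
  ...   | hangs _ ρc a = (up s u , a , centreHas1 _ ρc (u , ρ , refl)) , (up s u , a , centreHas2 _ ρc)
  rainbowValid u empty | knee with local I (complete u) ρ
  ...   | hangs _ ρc a , hasFoot _ ρo _ =
    (down s u , footAdj u ρ , footHas1 _ ρo) , (up s u , a , centreHas2 _ ρc)

  romanValid : IsRomanDF G roman
  romanValid = bounded , dominated
    where
    bounded : ∀ u → roman u ≤ 2
    bounded u with role s u
    ... | centre = ≤-refl
    ... | leaf   = z≤n
    ... | knee   = z≤n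
    ... | foot   = s≤s z≤n
    centre2 : ∀ c → role s c ≡ centre → roman c ≡ 2
    centre2 c ρ rewrite ρ = refl
    dominated : ∀ u → roman u ≡ 0 → ∃ λ v → (adj G u v ≡ true) × (roman v ≡ 2)
    dominated u g0 with role s u in ρ
    dominated u () | centre
    dominated u () | foot
    dominated u g0 | leaf with local I (complete u) ρ
    ...   | hangs _ ρc a = up s u , a , centre2 _ ρc
    dominated u g0 | knee with local I (complete u) ρ
    ...   | hangs _ ρc a , _ = up s u , a , centre2 _ ρc

  cost : Fin n → ℕ
  cost x = 8 * card12 (rainbow x) + 4 * roman x

  toUp toDown : Role → ℕ
  toUp leaf   = 9
  toUp knee   = 6
  toUp centre = 0
  toUp foot   = 0
  toDown knee   = 3
  toDown leaf   = 0
  toDown centre = 0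
  toDown foot   = 0

  gift : Fin n → Fin n → ℕ
  gift x y = point (up s x) (toUp (role s x)) y + point (down s x) (toDown (role s x)) y

  given : ∀ x → ∑ (gift x) ≡ toUp (role s x) + toDown (role s x)
  given x = trans (∑-distrib-+ (point (up s x) (toUp (role s x))) (point (down s x) (toDown (role s x))))
                  (cong₂ _+_ (∑-point (up s x) _) (∑-point (down s x) _))

  received : Fin n → ℕ
  received x = ∑ (λ y → gift y x)

  legGives : ∀ {a x} → Leg s a x → 6 ≤ gift a x
  legGives {a} {x} (leg _ u isLeg) =
    ≤-trans (atLeast6 isLeg) (≤-trans (≤-reflexive (sym (point-at _ u))) (m≤m+n _ _))
    where
    atLeast6 : IsLeg (role s a) → 6 ≤ toUp (role s a)
    atLeast6 (inj₁ ρ) rewrite ρ = m≤m+n 6 3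
    atLeast6 (inj₂ ρ) rewrite ρ = ≤-refl

  leafGives : ∀ {ℓ x} → LeafOf x ℓ → 9 ≤ gift ℓ x
  leafGives {ℓ} (ρ , u) rewrite point-at (toUp (role s ℓ)) u | ρ = m≤m+n 9 _

  kneeGives : ∀ {k x} → role s k ≡ knee → down s k ≡ x → 3 ≤ gift k x
  kneeGives {k} ρ d rewrite point-at (toDown (role s k)) d | ρ = m≤n+m 3 _

  otherLeg : ∀ {x} → TwoLegs s x → ∀ ℓ → Σ (Fin n) λ c → (ℓ ≢ c) × Leg s c x
  otherLeg (twoLegs {a} {b} a≢b la lb) ℓ with ℓ ≟ a
  ... | yes refl = b , a≢b , lb
  ... | no ℓ≢a   = a , ℓ≢a , la

  balance : ∀ x → cost x + ∑ (gift x) ≤ 9 + received x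
  balance x rewrite given x with role s x in ρ
  ... | leaf = m≤m+n 9 _
  ... | knee = m≤m+n 9 _
  ... | foot with local I (complete x) ρ
  ...   | hangs _ ρk _ , d = +-monoʳ-≤ 9 (≤-trans (kneeGives ρk d) (∑-term (λ y → gift y x) (up s x)))
  balance x | centre with hasLeaf? x | local I (complete x) ρ
  ... | yes (ℓ , isLeaf) | legs with otherLeg legs ℓ
  ...   | c , ℓ≢c , lc =
    +-monoʳ-≤ 9 (≤-trans (+-mono-≤ (leafGives isLeaf) (legGives lc)) (∑-terms (λ y → gift y x) ℓ≢c))
  balance x | centre | no _ | twoLegs a≢b la lb =
    ≤-trans (m≤m+n 16 5)
            (+-monoʳ-≤ 9 (≤-trans (+-mono-≤ (legGives la) (legGives lb)) (∑-terms (λ y → gift y x) a≢b)))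

  weightBound : 8 * weightR2 rainbow + 4 * vsum roman ≤ 9 * n
  weightBound = begin
    8 * weightR2 rainbow + 4 * vsum roman
      ≡⟨ cong₂ (λ p q → 8 * p + 4 * q) (vsum≡∑ (λ x → card12 (rainbow x))) (vsum≡∑ roman) ⟩
    8 * ∑ (λ x → card12 (rainbow x)) + 4 * ∑ roman
      ≡⟨ cong₂ _+_ (*-distribˡ-sum 8 (λ x → card12 (rainbow x))) (*-distribˡ-sum 4 roman) ⟩
    ∑ (λ x → 8 * card12 (rainbow x)) + ∑ (λ x → 4 * roman x)
      ≡⟨ sym (∑-distrib-+ {n} (λ x → 8 * card12 (rainbow x)) (λ x → 4 * roman x)) ⟩
    ∑ cost
      ≤⟨ discharging cost gift 9 balance ⟩
    n * 9
      ≡⟨ *-comm n 9 ⟩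
    9 * n ∎
    where open ≤-Reasoning

boundByWitnesses : ∀ {n} (G : Graph n) (f : Fin n → Sub12) (g : Fin n → ℕ) →
  IsRainbow2DF G f → IsRomanDF G g → 8 * weightR2 f + 4 * vsum g ≤ 9 * n →
  ∀ a b → IsGammaR2 G a → IsGammaR G b → 4 * (2 * a + b) ≤ 9 * n
boundByWitnesses {n} G f g fValid gValid fg a b (_ , aMin) (_ , bMin) = begin
  4 * (2 * a + b)     ≡⟨ *-distribˡ-+ 4 (2 * a) b ⟩
  4 * (2 * a) + 4 * b ≡⟨ cong (_+ 4 * b) (sym (*-assoc 4 2 a)) ⟩
  8 * a + 4 * b       ≤⟨ +-mono-≤ (*-monoʳ-≤ 8 (aMin f fValid)) (*-monoʳ-≤ 4 (bMin g gValid)) ⟩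
  8 * weightR2 f + 4 * vsum g ≤⟨ fg ⟩
  9 * n               ∎
  where open ≤-Reasoning

_[_≔_] : ∀ {n} {A : Set} → (Fin n → A) → Fin n → A → Fin n → A
h [ a ≔ c ] = updateAt h a (const c)

≔-hit : ∀ {n} {A : Set} (h : Fin n → A) a {c : A} → (h [ a ≔ c ]) a ≡ c
≔-hit h a = updateAt-updates a h

≔-miss : ∀ {n} {A : Set} {h : Fin n → A} {a x : Fin n} {c : A} → x ≢ a → (h [ a ≔ c ]) x ≡ h x
≔-miss {h = h} {a} {x} x≢a = updateAt-minimal x a h x≢a

mapLegs : ∀ {n} {s t : Spiders n} {x} → (∀ {a} → Leg s a x → Leg t a x) → TwoLegs s x → TwoLegs t x
mapLegs f (twoLegs a≢b la lb) = twoLegs a≢b (f la) (f lb)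

SamePair : ∀ {A : Set} → A → A → A → A → Set
SamePair y z m o = ((y ≡ m) × (z ≡ o)) ⊎ ((y ≡ o) × (z ≡ m))

avoidPair : ∀ {A : Set} {x y z m o : A} → SamePair y z m o → x ≢ m → x ≢ o → (x ≢ y) × (x ≢ z)
avoidPair (inj₁ (refl , refl)) x≢m x≢o = x≢m , x≢o
avoidPair (inj₂ (refl , refl)) x≢m x≢o = x≢o , x≢m

allPair : ∀ {A : Set} {P : A → Set} {y z m o : A} {xs : List A} →
          SamePair y z m o → P y → P z → All P xs → All P (m ∷ o ∷ xs)
allPair (inj₁ (refl , refl)) py pz pxs = py ∷ pz ∷ pxs
allPair (inj₂ (refl , refl)) py pz pxs = pz ∷ py ∷ pxs

module Growth {n : ℕ} (G : Graph n) where

  legRoleNotCentre : ∀ {ρ} → IsLeg ρ → ρ ≢ centre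
  legRoleNotCentre (inj₁ refl) ()
  legRoleNotCentre (inj₂ refl) ()

  notCentre : ∀ {ρ r : Role} → ρ ≡ r → r ≢ centre → ρ ≢ centre
  notCentre refl r≢c = r≢c

  ParentRole : Role → Set
  ParentRole r = (r ≡ centre) ⊎ (r ≡ knee)

  notParentRole : ∀ {r} → ParentRole r → (r ≡ leaf) ⊎ (r ≡ foot) → ⊥
  notParentRole (inj₁ refl) (inj₁ ())
  notParentRole (inj₁ refl) (inj₂ ())
  notParentRole (inj₂ refl) (inj₁ ())
  notParentRole (inj₂ refl) (inj₂ ())

  module Structure (s : Spiders n) (I : Valid G s) where

    roleDiff : ∀ {a b r r'} → role s a ≡ r → role s b ≡ r' → r ≢ r' → a ≢ b
    roleDiff ρa ρb r≢r' refl = r≢r' (trans (sym ρa) ρb)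

    legNotFoot : ∀ {a b} → IsLeg (role s a) → role s b ≡ foot → a ≢ b
    legNotFoot (inj₁ ρ) ρb = roleDiff ρ ρb λ ()
    legNotFoot (inj₂ ρ) ρb = roleDiff ρ ρb λ ()

    legNotCentre : ∀ {a b} → IsLeg (role s a) → role s b ≡ centre → a ≢ b
    legNotCentre (inj₁ ρ) ρb = roleDiff ρ ρb λ ()
    legNotCentre (inj₂ ρ) ρb = roleDiff ρ ρb λ ()

    data Parent (x : Fin n) : Set where
      legOf  : IsLeg (role s x) → HangsBelow G s centre x → Parent x
      footOf : HangsBelow G s knee x → down s (up s x) ≡ x → Parent x

    parent : ∀ {x} → inside s x ≡ true → role s x ≢ centre → Parent x
    parent {x} hx nc with role s x in ρ | I x hx
    ... | centre | _        = ⊥-elim (nc refl)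
    ... | leaf   | h        = legOf (inj₁ ρ) h
    ... | knee   | (h , _)  = legOf (inj₂ ρ) h
    ... | foot   | (h , d)  = footOf h d

    hangsBelowParent : ∀ {x} → Parent x → Σ Role λ r → HangsBelow G s r x
    hangsBelowParent (legOf _ h)  = centre , h
    hangsBelowParent (footOf h _) = knee , h

    upInside : ∀ {x} → inside s x ≡ true → role s x ≢ centre → inside s (up s x) ≡ true
    upInside hx nc = HangsBelow.aboveInside (proj₂ (hangsBelowParent (parent hx nc)))

    upAdj : ∀ {x} → inside s x ≡ true → role s x ≢ centre → adj G x (up s x) ≡ true
    upAdj hx nc = HangsBelow.aboveAdj (proj₂ (hangsBelowParent (parent hx nc)))

    belowKnee : ∀ {x} → inside s x ≡ true → role s x ≢ centre → role s (up s x) ≡ knee → down s (up s x) ≡ x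
    belowKnee hx nc ρ with parent hx nc
    ... | footOf _ d = d
    ... | legOf _ (hangs _ ρc _) with trans (sym ρc) ρ
    ...   | ()

    belowCentre : ∀ {x} → inside s x ≡ true → role s x ≢ centre → role s (up s x) ≡ centre → IsLeg (role s x)
    belowCentre hx nc ρ with parent hx nc
    ... | legOf isLeg _ = isLeg
    ... | footOf (hangs _ ρk _) _ with trans (sym ρk) ρ
    ...   | ()

    upRole : ∀ {x} → inside s x ≡ true → role s x ≢ centre → ParentRole (role s (up s x))
    upRole hx nc with parent hx nc
    ... | legOf _ h  = inj₁ (HangsBelow.aboveRole h)
    ... | footOf h _ = inj₂ (HangsBelow.aboveRole h)

    notBelow : ∀ {x r} → inside s x ≡ true → role s x ≢ centre → (r ≡ leaf) ⊎ (r ≡ foot) →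
               role s (up s x) ≢ r
    notBelow hx nc r≡ ρ = notParentRole (upRole hx nc) (Data.Sum.map (trans ρ) (trans ρ) r≡)

    footOfKnee : ∀ {k} → inside s k ≡ true → role s k ≡ knee → HasFoot s k
    footOfKnee hk ρ = proj₂ (local I hk ρ)

    isFootOf : ∀ {x k} → inside s x ≡ true → role s x ≢ centre → up s x ≡ k → role s k ≡ knee → x ≡ down s k
    isFootOf hx nc e kK = trans (sym (belowKnee hx nc (trans (cong (role s) e) kK))) (cong (down s) e)

    isKneeOf : ∀ {x f k} → inside s x ≡ true → role s x ≡ knee → down s x ≡ f → up s f ≡ k → x ≡ k
    isKneeOf hx ρ e u = trans (sym (HasFoot.footUp (footOfKnee hx ρ))) (trans (cong (up s) e) u)

  open import Data.List.Membership.DecPropositional (_≟_ {n}) using (_∈?_)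

  module Step (s : Spiders n) (I : Valid G s) (v y : Fin n)
              (hv : inside s v ≡ false) (hy : inside s y ≡ true) (avy : adj G v y ≡ true) where
    open Structure s I

    inside' : Fin n → Bool
    inside' = inside s [ v ≔ true ]

    Grown : Set
    Grown = Σ (Spiders n) λ t → Valid G t × (inside t ≡ inside')

    ≢v : ∀ {x} → inside s x ≡ true → x ≢ v
    ≢v hx refl with trans (sym hx) hv
    ... | ()

    vInside : inside' v ≡ true
    vInside = ≔-hit (inside s) v

    stillInside : ∀ {x} → inside s x ≡ true → inside' x ≡ true
    stillInside hx = trans (≔-miss (≢v hx)) hx

    Off : List (Fin n) → Fin n → Set
    Off L x = All (x ≢_) (v ∷ L)

    Agrees : List (Fin n) → (Fin n → Role) → (Fin n → Fin n) → (Fin n → Fin n) → Set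
    Agrees L role' up' down' =
      ∀ {x} → Off L x → (role' x ≡ role s x) × (up' x ≡ up s x) × (down' x ≡ down s x)

    UpClosed DownClosed : List (Fin n) → Set
    UpClosed L   = ∀ {x} → Off L x → inside s x ≡ true → role s x ≢ centre → Off L (up s x)
    DownClosed L = ∀ {x} → Off L x → inside s x ≡ true → role s x ≡ knee → Off L (down s x)

    -- Suppose the new role, up and down agree with the old ones
    -- off v ∷ L.  If the old parent and foot of a vertex off v ∷ L are off
    -- v ∷ L as well, old centres off v ∷ L keep two legs, and the vertices
    -- of v ∷ L satisfy their new local conditions, then the new cover is
    -- valid.
    module Rearrange (L : List (Fin n)) (role' : Fin n → Role) (up' down' : Fin n → Fin n)
                     (same : Agrees L role' up' down') where

      s' : Spiders n
      s' = spiders inside' role' up' down'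

      keepLeg : ∀ {a x} → Off L a → Leg s a x → Leg s' a x
      keepLeg off (leg ha u isLeg) =
        leg (stillInside ha) (trans (proj₁ (proj₂ (same off))) u) (subst IsLeg (sym (proj₁ (same off))) isLeg)

      keepLegs : ∀ {x} → (∀ {a} → Leg s a x → Off L a) → TwoLegs s x → TwoLegs s' x
      keepLegs off = mapLegs (λ l → keepLeg (off l) l)

      LegsKept : Set
      LegsKept = ∀ {x} → Off L x → inside s x ≡ true → role s x ≡ centre → TwoLegs s' x

      module _ (upOff : UpClosed L) (downOff : DownClosed L) (legsKept : LegsKept)
               (special : All (λ a → Local G s' a (role' a)) (v ∷ L)) where

        keepHang : ∀ {x r} → Off L x → inside s x ≡ true → role s x ≢ centre →
                   HangsBelow G s r x → HangsBelow G s' r x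
        keepHang off hx nc (hangs hu ρ a) =
          hangsVia (proj₁ (proj₂ (same off))) (stillInside hu) (trans (proj₁ (same (upOff off hx nc))) ρ) a

        keepLocal : ∀ {x} → Off L x → inside s x ≡ true → ∀ {r} → role s x ≡ r →
                    Local G s x r → Local G s' x r
        keepLocal off hx {centre} ρ _ = legsKept off hx ρ
        keepLocal off hx {leaf}   ρ h = keepHang off hx (notCentre ρ λ ()) h
        keepLocal {x} off hx {knee} ρ (h , hasFoot hf ρf uf) =
          keepHang off hx (notCentre ρ λ ()) h ,
          footVia (proj₂ (proj₂ (same off))) (stillInside hf)
                  (trans (proj₁ (same footOff)) ρf) (trans (proj₁ (proj₂ (same footOff))) uf)
          where
          footOff : Off L (down s x)
          footOff = downOff off hx ρ
        keepLocal {x} off hx {foot} ρ (h , d) =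
          keepHang off hx nc h ,
          trans (cong down' (proj₁ (proj₂ (same off)))) (trans (proj₂ (proj₂ (same (upOff off hx nc)))) d)
          where
          nc : role s x ≢ centre
          nc = notCentre ρ λ ()

        valid : Valid G s'
        valid x hx' with x ∈? (v ∷ L)
        ... | yes special-x = lookup special special-x
        ... | no ¬special with ¬Any⇒All¬ (v ∷ L) ¬special
        ...   | off@(x≢v ∷ _) =
          subst (Local G s' x) (sym (proj₁ (same off)))
                (keepLocal off hx refl (I x hx))
          where
          hx : inside s x ≡ true
          hx = trans (sym (≔-miss x≢v)) hx'

        grown : Grown
        grown = s' , valid , refl

    -- y is a centre: v becomes a new leaf of y.
    attachLeaf : role s y ≡ centre → Grown
    attachLeaf yC = R.grown upOff downOff legsKept (vLocal ∷ [])
      where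
      same : Agrees [] (role s [ v ≔ leaf ]) (up s [ v ≔ y ]) (down s)
      same (x≢v ∷ []) = ≔-miss x≢v , ≔-miss x≢v , refl
      module R = Rearrange [] (role s [ v ≔ leaf ]) (up s [ v ≔ y ]) (down s) same
      upOff : UpClosed []
      upOff _ hx nc = ≢v (upInside hx nc) ∷ []
      downOff : DownClosed []
      downOff _ hx ρ = ≢v (HasFoot.footInside (footOfKnee hx ρ)) ∷ []
      legsKept : R.LegsKept
      legsKept _ hx ρ = R.keepLegs (λ l → ≢v (Leg.legInside l) ∷ []) (local I hx ρ)
      vLocal : Local G R.s' v (role R.s' v)
      vLocal = withRole (≔-hit (role s) v) $
        hangsVia (≔-hit (up s) v) (stillInside hy) (trans (≔-miss (≢v hy)) yC) avy

    -- y is a leaf: y becomes a knee and v its foot.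
    extendLeg : role s y ≡ leaf → Grown
    extendLeg yL = R.grown upOff downOff legsKept (vLocal ∷ yLocal ∷ [])
      where
      role' : Fin n → Role
      role' = role s [ y ≔ knee ] [ v ≔ foot ]
      y≢v : y ≢ v
      y≢v = ≢v hy
      yKnee : role' y ≡ knee
      yKnee = trans (≔-miss y≢v) (≔-hit (role s) y)
      same : Agrees (y ∷ []) role' (up s [ v ≔ y ]) (down s [ y ≔ v ])
      same (x≢v ∷ x≢y ∷ []) = trans (≔-miss x≢v) (≔-miss x≢y) , ≔-miss x≢v , ≔-miss x≢y
      module R = Rearrange (y ∷ []) role' (up s [ v ≔ y ]) (down s [ y ≔ v ]) same
      upOff : UpClosed (y ∷ [])
      upOff _ hx nc =
        ≢v (upInside hx nc) ∷ (λ e → notBelow hx nc (inj₁ refl) (trans (cong (role s) e) yL)) ∷ []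
      downOff : DownClosed (y ∷ [])
      downOff _ hx ρ = ≢v footInside ∷ roleDiff footRole yL (λ ()) ∷ []
        where open HasFoot (footOfKnee hx ρ)
      -- y stays a leg of its centre, now as a knee
      legsKept : R.LegsKept
      legsKept _ hx ρ = mapLegs keep (local I hx ρ)
        where
        keep : ∀ {a x} → Leg s a x → Leg R.s' a x
        keep {a} l with a ≟ y
        ... | yes refl = leg (stillInside hy) (trans (≔-miss y≢v) (Leg.legUp l)) (inj₂ yKnee)
        ... | no a≢y   = R.keepLeg (≢v (Leg.legInside l) ∷ a≢y ∷ []) l
      vLocal : Local G R.s' v (role' v)
      vLocal = withRole (≔-hit (role s [ y ≔ knee ]) v) $
        hangsVia (≔-hit (up s) v) (stillInside hy) yKnee avy ,
        trans (cong (down s [ y ≔ v ]) (≔-hit (up s) v)) (≔-hit (down s) y)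
      yLocal : Local G R.s' y (role' y)
      yLocal with local I hy yL
      ... | hangs hc ρc ayc = withRole yKnee $
        hangsVia (≔-miss y≢v) (stillInside hc)
                 (trans (≔-miss (≢v hc)) (trans (≔-miss (roleDiff ρc yL λ ())) ρc)) ayc ,
        footVia (≔-hit (down s) y) vInside (≔-hit (role s [ y ≔ knee ]) v) (≔-hit (up s) v)

    -- y lies on the leg m–o of the centre r: m is a knee, o its foot.
    module OnLeg (m : Fin n) (hm : inside s m ≡ true) (mK : role s m ≡ knee) where

      o r : Fin n
      o = down s m
      r = up s m

      open HangsBelow (proj₁ (local I hm mK)) renaming (aboveInside to hr; aboveRole to rC; aboveAdj to amr)
      open HasFoot (proj₂ (local I hm mK)) renaming (footInside to ho; footRole to oF; footUp to om)

      aom : adj G o m ≡ true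
      aom = subst (λ p → adj G o p ≡ true) om (HangsBelow.aboveAdj (proj₁ (local I ho oF)))

      o≢m : o ≢ m
      o≢m = roleDiff oF mK λ ()

      data OtherLegs : Set where
        twoMore : ∀ {a b} → a ≢ b → Leg s a r → Leg s b r → a ≢ m → b ≢ m → OtherLegs
        oneMore : ∀ {w} → Leg s w r → w ≢ m → (∀ {c} → Leg s c r → c ≢ m → c ≡ w) → OtherLegs

      someOtherLeg : Σ (Fin n) λ w → Leg s w r × (w ≢ m)
      someOtherLeg with local I hr rC
      ... | twoLegs {a} {b} a≢b la lb with a ≟ m
      ...   | yes refl = b , lb , λ e → a≢b (sym e)
      ...   | no a≢m   = a , la , a≢m

      otherLegs : OtherLegs
      otherLegs with someOtherLeg
      ... | w , lw , w≢m with any? (λ c → (leg? s c r ×-dec ¬? (c ≟ m)) ×-dec ¬? (c ≟ w))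
      ...   | yes (c , (lc , c≢m) , c≢w) = twoMore c≢w lc lw c≢m w≢m
      ...   | no none = oneMore lw w≢m unique
        where
        unique : ∀ {c} → Leg s c r → c ≢ m → c ≡ w
        unique {c} lc c≢m with c ≟ w
        ... | yes c≡w = c≡w
        ... | no c≢w  = ⊥-elim (none (c , (lc , c≢m) , c≢w))

      upOffLeg : ∀ {x} → x ≢ m → x ≢ o → inside s x ≡ true → role s x ≢ centre →
                 All (up s x ≢_) (v ∷ m ∷ o ∷ [])
      upOffLeg x≢m x≢o hx nc =
        ≢v (upInside hx nc) ∷
        (λ e → x≢o (isFootOf hx nc e mK)) ∷
        (λ e → notBelow hx nc (inj₂ refl) (trans (cong (role s) e) oF)) ∷ []

      downOffLeg : ∀ {x} → x ≢ m → inside s x ≡ true → role s x ≡ knee →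
                   All (down s x ≢_) (v ∷ m ∷ o ∷ [])
      downOffLeg x≢m hx ρ =
        ≢v footInside ∷ roleDiff footRole mK (λ ()) ∷ (λ e → x≢m (isKneeOf hx ρ e om)) ∷ []
        where open HasFoot (footOfKnee hx ρ)

      legOffLeg : ∀ {a x} → Leg s a x → a ≢ m → All (a ≢_) (v ∷ m ∷ o ∷ [])
      legOffLeg (leg ha _ isLeg) a≢m = ≢v ha ∷ a≢m ∷ legNotFoot isLeg oF ∷ []

      notM : ∀ {a x} → Leg s a x → x ≢ r → a ≢ m
      notM (leg _ u _) x≢r e = x≢r (trans (sym u) (cong (up s) e))

      legPair : ∀ {a b} → SamePair a b m o → (inside s b ≡ true) × (b ≢ a) × (adj G b a ≡ true)
      legPair (inj₁ (refl , refl)) = ho , o≢m , aom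
      legPair (inj₂ (refl , refl)) = hm , (λ e → o≢m (sym e)) , adjSym G aom

      -- The leg m–o and v form a new spider with centre y and leaves z, v,
      -- where {y, z} = {m, o}; the other vertices keep their base values.
      module NewSpider (z : Fin n) (yz : SamePair y z m o)
                       (baseRole : Fin n → Role) (baseUp : Fin n → Fin n) where

        role' : Fin n → Role
        role' = baseRole [ v ≔ leaf ] [ z ≔ leaf ] [ y ≔ centre ]

        up' : Fin n → Fin n
        up' = baseUp [ v ≔ y ] [ z ≔ y ]

        pairFacts : (inside s z ≡ true) × (z ≢ y) × (adj G z y ≡ true)
        pairFacts = legPair yz

        hz : inside s z ≡ true
        hz = proj₁ pairFacts

        z≢y : z ≢ y
        z≢y = proj₁ (proj₂ pairFacts)

        v≢y : v ≢ y
        v≢y e = ≢v hy (sym e)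

        v≢z : v ≢ z
        v≢z e = ≢v hz (sym e)

        roleOff : ∀ {x} → All (x ≢_) (v ∷ m ∷ o ∷ []) → role' x ≡ baseRole x
        roleOff (x≢v ∷ x≢m ∷ x≢o ∷ []) with avoidPair yz x≢m x≢o
        ... | x≢y , x≢z = trans (≔-miss x≢y) (trans (≔-miss x≢z) (≔-miss x≢v))

        upOff : ∀ {x} → All (x ≢_) (v ∷ m ∷ o ∷ []) → up' x ≡ baseUp x
        upOff (x≢v ∷ x≢m ∷ x≢o ∷ []) with avoidPair yz x≢m x≢o
        ... | _ , x≢z = trans (≔-miss x≢z) (≔-miss x≢v)

        yCentre : role' y ≡ centre
        yCentre = ≔-hit _ y

        -- The local conditions of v, m and o, whatever the feet of the other vertices.
        specials : ∀ (down' : Fin n → Fin n) {rest} →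
          All (λ a → Local G (spiders inside' role' up' down') a (role' a)) rest →
          All (λ a → Local G (spiders inside' role' up' down') a (role' a)) (v ∷ m ∷ o ∷ rest)
        specials down' others = vLocal ∷ allPair yz yLocal zLocal others
          where
          t : Spiders n
          t = spiders inside' role' up' down'
          zLeaf : role' z ≡ leaf
          zLeaf = trans (≔-miss z≢y) (≔-hit _ z)
          vLeaf : role' v ≡ leaf
          vLeaf = trans (≔-miss v≢y) (trans (≔-miss v≢z) (≔-hit _ v))
          zUp : up' z ≡ y
          zUp = ≔-hit _ z
          vUp : up' v ≡ y
          vUp = trans (≔-miss v≢z) (≔-hit _ v)
          yLocal : Local G t y (role' y)
          yLocal = withRole yCentre $
            twoLegs (λ e → v≢z (sym e)) (leg (stillInside hz) zUp (inj₁ zLeaf)) (leg vInside vUp (inj₁ vLeaf))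
          zLocal : Local G t z (role' z)
          zLocal = withRole zLeaf $ hangsVia zUp (stillInside hy) yCentre (proj₂ (proj₂ pairFacts))
          vLocal : Local G t v (role' v)
          vLocal = withRole vLeaf $ hangsVia vUp (stillInside hy) yCentre avy

      -- r keeps two other legs: the leg m–o leaves r and, with v, forms a
      -- spider centred at y.
      moveLeg : ∀ {z a b} → SamePair y z m o → a ≢ b → Leg s a r → Leg s b r → a ≢ m → b ≢ m → Grown
      moveLeg {z} yz a≢b la lb a≢m b≢m = R.grown upOff downOff legsKept (N.specials (down s) [])
        where
        module N = NewSpider z yz (role s) (up s)
        same : Agrees (m ∷ o ∷ []) N.role' N.up' (down s)
        same off = N.roleOff off , N.upOff off , refl
        module R = Rearrange (m ∷ o ∷ []) N.role' N.up' (down s) same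
        upOff : UpClosed (m ∷ o ∷ [])
        upOff (_ ∷ x≢m ∷ x≢o ∷ []) hx nc = upOffLeg x≢m x≢o hx nc
        downOff : DownClosed (m ∷ o ∷ [])
        downOff (_ ∷ x≢m ∷ _) hx ρ = downOffLeg x≢m hx ρ
        legsKept : R.LegsKept
        legsKept {x} _ hx ρ with x ≟ r
        ... | yes refl = twoLegs a≢b (R.keepLeg (legOffLeg la a≢m) la) (R.keepLeg (legOffLeg lb b≢m) lb)
        ... | no x≢r   = R.keepLegs (λ l → legOffLeg l (notM l x≢r)) (local I hx ρ)

      module OneMore {w : Fin n} (lw : Leg s w r) (w≢m : w ≢ m)
                     (unique : ∀ {c} → Leg s c r → c ≢ m → c ≡ w) where

        open Leg lw renaming (legInside to hw; legUp to wr; legShape to wLeg)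

        awr : adj G w r ≡ true
        awr = subst (λ p → adj G w p ≡ true) wr (upAdj hw (legRoleNotCentre wLeg))

        w≢r : w ≢ r
        w≢r = legNotCentre wLeg rC

        offR : All (r ≢_) (v ∷ m ∷ o ∷ [])
        offR = ≢v hr ∷ roleDiff rC mK (λ ()) ∷ roleDiff rC oF (λ ()) ∷ []

        offW : All (w ≢_) (v ∷ m ∷ o ∷ [])
        offW = legOffLeg lw w≢m

        upNotR : ∀ {x} → x ≢ m → x ≢ w → inside s x ≡ true → role s x ≢ centre → up s x ≢ r
        upNotR x≢m x≢w hx nc e =
          x≢w (unique (leg hx e (belowCentre hx nc (trans (cong (role s) e) rC))) x≢m)

        legNotRW : ∀ {a x} → Leg s a x → x ≢ r → All (a ≢_) (r ∷ w ∷ [])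
        legNotRW (leg _ u isLeg) x≢r =
          legNotCentre isLeg rC ∷ (λ e → x≢r (trans (sym u) (trans (cong (up s) e) wr))) ∷ []

        -- w is a knee with foot f: the spider of r is re-rooted at w, with
        -- leaves r and f, and the leg m–o together with v forms a spider
        -- centred at y.
        reroot : ∀ {z} → SamePair y z m o → role s w ≡ knee → Grown
        reroot {z} yz wK =
          R.grown upOff downOff legsKept (N.specials (down s) (rLocal ∷ wLocal ∷ fLocal ∷ []))
          where
          f : Fin n
          f = down s w
          open HasFoot (footOfKnee hw wK) renaming (footInside to hf; footRole to fF; footUp to fw)
          afw : adj G f w ≡ true
          afw = subst (λ p → adj G f p ≡ true) fw (upAdj hf (notCentre fF λ ()))
          f≢w : f ≢ w
          f≢w = roleDiff fF wK λ ()
          f≢r : f ≢ r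
          f≢r = roleDiff fF rC λ ()
          offF : All (f ≢_) (v ∷ m ∷ o ∷ [])
          offF = ≢v hf ∷ roleDiff fF mK (λ ()) ∷ (λ e → w≢m (trans (sym fw) (trans (cong (up s) e) om))) ∷ []
          L : List (Fin n)
          L = m ∷ o ∷ r ∷ w ∷ f ∷ []
          module N = NewSpider z yz (role s [ f ≔ leaf ] [ r ≔ leaf ] [ w ≔ centre ]) (up s [ r ≔ w ])
          same : Agrees L N.role' N.up' (down s)
          same (x≢v ∷ x≢m ∷ x≢o ∷ x≢r ∷ x≢w ∷ x≢f ∷ []) =
            trans (N.roleOff (x≢v ∷ x≢m ∷ x≢o ∷ [])) (trans (≔-miss x≢w) (trans (≔-miss x≢r) (≔-miss x≢f))) ,
            trans (N.upOff (x≢v ∷ x≢m ∷ x≢o ∷ [])) (≔-miss x≢r) , refl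
          module R = Rearrange L N.role' N.up' (down s) same
          upOff : UpClosed L
          upOff (_ ∷ x≢m ∷ x≢o ∷ _ ∷ x≢w ∷ x≢f ∷ []) hx nc =
            ++⁺ (upOffLeg x≢m x≢o hx nc)
            (upNotR x≢m x≢w hx nc ∷ (λ e → x≢f (isFootOf hx nc e wK)) ∷
             (λ e → notBelow hx nc (inj₂ refl) (trans (cong (role s) e) fF)) ∷ [])
          downOff : DownClosed L
          downOff (_ ∷ x≢m ∷ _ ∷ _ ∷ x≢w ∷ _) hx ρ =
            ++⁺ (downOffLeg x≢m hx ρ)
            (roleDiff footRole rC (λ ()) ∷ roleDiff footRole wK (λ ()) ∷
             (λ e → x≢w (isKneeOf hx ρ e fw)) ∷ [])
            where open HasFoot (footOfKnee hx ρ)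
          legsKept : R.LegsKept
          legsKept (_ ∷ _ ∷ _ ∷ x≢r ∷ _) hx ρ =
            R.keepLegs (λ l → ++⁺ (legOffLeg l (notM l x≢r))
                                  (++⁺ (legNotRW l x≢r) (legNotFoot (Leg.legShape l) fF ∷ [])))
                       (local I hx ρ)
          wCentre : N.role' w ≡ centre
          wCentre = trans (N.roleOff offW) (≔-hit _ w)
          rLeaf : N.role' r ≡ leaf
          rLeaf = trans (N.roleOff offR) (trans (≔-miss (λ e → w≢r (sym e))) (≔-hit _ r))
          fLeaf : N.role' f ≡ leaf
          fLeaf = trans (N.roleOff offF) (trans (≔-miss f≢w) (trans (≔-miss f≢r) (≔-hit _ f)))
          rUp : N.up' r ≡ w
          rUp = trans (N.upOff offR) (≔-hit _ r)
          fUp : N.up' f ≡ w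
          fUp = trans (N.upOff offF) (trans (≔-miss f≢r) fw)
          wLocal : Local G R.s' w (N.role' w)
          wLocal = withRole wCentre $
            twoLegs (λ e → f≢r (sym e)) (leg (stillInside hr) rUp (inj₁ rLeaf))
                                        (leg (stillInside hf) fUp (inj₁ fLeaf))
          rLocal : Local G R.s' r (N.role' r)
          rLocal = withRole rLeaf $ hangsVia rUp (stillInside hw) wCentre (adjSym G awr)
          fLocal : Local G R.s' f (N.role' f)
          fLocal = withRole fLeaf $ hangsVia fUp (stillInside hw) wCentre afw

        -- w is a leaf: r becomes a knee of m with foot w.
        module WLeaf (wL : role s w ≡ leaf) where

          L : List (Fin n)
          L = m ∷ o ∷ r ∷ w ∷ []

          baseRole : Fin n → Role
          baseRole = role s [ w ≔ foot ] [ r ≔ knee ]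

          baseUp baseDown : Fin n → Fin n
          baseUp   = up s [ r ≔ m ]
          baseDown = down s [ r ≔ w ]

          OnBase : (Fin n → Role) → (Fin n → Fin n) → (Fin n → Fin n) → Set
          OnBase role' up' down' = ∀ {x} → All (x ≢_) (v ∷ m ∷ o ∷ []) →
            (role' x ≡ baseRole x) × (up' x ≡ baseUp x) × (down' x ≡ baseDown x)

          agrees : ∀ {role' up' down'} → OnBase role' up' down' → Agrees L role' up' down'
          agrees onBase (x≢v ∷ x≢m ∷ x≢o ∷ x≢r ∷ x≢w ∷ []) with onBase (x≢v ∷ x≢m ∷ x≢o ∷ [])
          ... | eRole , eUp , eDown =
            trans eRole (trans (≔-miss x≢r) (≔-miss x≢w)) , trans eUp (≔-miss x≢r) , trans eDown (≔-miss x≢r)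

          upOff : UpClosed L
          upOff (_ ∷ x≢m ∷ x≢o ∷ _ ∷ x≢w ∷ []) hx nc =
            ++⁺ (upOffLeg x≢m x≢o hx nc)
                (upNotR x≢m x≢w hx nc ∷ (λ e → notBelow hx nc (inj₁ refl) (trans (cong (role s) e) wL)) ∷ [])

          downOff : DownClosed L
          downOff (_ ∷ x≢m ∷ _) hx ρ =
            ++⁺ (downOffLeg x≢m hx ρ) (roleDiff footRole rC (λ ()) ∷ roleDiff footRole wL (λ ()) ∷ [])
            where open HasFoot (footOfKnee hx ρ)

          legOff : ∀ {a x} → Leg s a x → x ≢ r → All (a ≢_) (v ∷ L)
          legOff l x≢r = ++⁺ (legOffLeg l (notM l x≢r)) (legNotRW l x≢r)

          module KneeR (role' : Fin n → Role) (up' down' : Fin n → Fin n)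
                       (onBase : OnBase role' up' down') (mCentre : role' m ≡ centre) where

            t : Spiders n
            t = spiders inside' role' up' down'

            rKnee : role' r ≡ knee
            rKnee = trans (proj₁ (onBase offR)) (≔-hit _ r)

            rUp : up' r ≡ m
            rUp = trans (proj₁ (proj₂ (onBase offR))) (≔-hit _ r)

            wFoot : role' w ≡ foot
            wFoot = trans (proj₁ (onBase offW)) (trans (≔-miss w≢r) (≔-hit _ w))

            wUp : up' w ≡ r
            wUp = trans (proj₁ (proj₂ (onBase offW))) (trans (≔-miss w≢r) wr)

            rDown : down' r ≡ w
            rDown = trans (proj₂ (proj₂ (onBase offR))) (≔-hit _ r)

            locals : All (λ a → Local G t a (role' a)) (r ∷ w ∷ [])
            locals =
              withRole rKnee (hangsVia rUp (stillInside hm) mCentre (adjSym G amr) ,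
                              footVia rDown (stillInside hw) wFoot wUp) ∷
              withRole wFoot (hangsVia wUp (stillInside hr) rKnee awr , trans (cong down' wUp) rDown) ∷ []

          -- y = m: m becomes a centre with leaves o and v and the leg r–w.
          atKnee : y ≡ m → Grown
          atKnee y≡m = R.grown upOff downOff legsKept (N.specials baseDown K.locals)
            where
            module N = NewSpider o (inj₁ (y≡m , refl)) baseRole baseUp
            onBase : OnBase N.role' N.up' baseDown
            onBase off = N.roleOff off , N.upOff off , refl
            module K = KneeR N.role' N.up' baseDown onBase (subst (λ a → N.role' a ≡ centre) y≡m N.yCentre)
            module R = Rearrange L N.role' N.up' baseDown (agrees onBase)
            legsKept : R.LegsKept
            legsKept (_ ∷ _ ∷ _ ∷ x≢r ∷ _) hx ρ = R.keepLegs (λ l → legOff l x≢r) (local I hx ρ)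

          -- y = o: m becomes a centre with the legs o–v and r–w.
          atFoot : y ≡ o → Grown
          atFoot y≡o = R.grown upOff downOff legsKept (vLocal ∷ mLocal ∷ oLocal ∷ K.locals)
            where
            role' : Fin n → Role
            role' = baseRole [ v ≔ foot ] [ o ≔ knee ] [ m ≔ centre ]
            up' down' : Fin n → Fin n
            up'   = baseUp [ v ≔ o ]
            down' = baseDown [ o ≔ v ]
            onBase : OnBase role' up' down'
            onBase (x≢v ∷ x≢m ∷ x≢o ∷ []) =
              trans (≔-miss x≢m) (trans (≔-miss x≢o) (≔-miss x≢v)) , ≔-miss x≢v , ≔-miss x≢o
            mCentre : role' m ≡ centre
            mCentre = ≔-hit _ m
            module K = KneeR role' up' down' onBase mCentre
            module R = Rearrange L role' up' down' (agrees onBase)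
            legsKept : R.LegsKept
            legsKept (_ ∷ _ ∷ _ ∷ x≢r ∷ _) hx ρ = R.keepLegs (λ l → legOff l x≢r) (local I hx ρ)
            v≢o : v ≢ o
            v≢o e = ≢v ho (sym e)
            oKnee : role' o ≡ knee
            oKnee = trans (≔-miss o≢m) (≔-hit _ o)
            vFoot : role' v ≡ foot
            vFoot = trans (≔-miss (λ e → ≢v hm (sym e))) (trans (≔-miss v≢o) (≔-hit _ v))
            vUp : up' v ≡ o
            vUp = ≔-hit _ v
            oUp : up' o ≡ m
            oUp = trans (≔-miss (≢v ho)) (trans (≔-miss (roleDiff oF rC λ ())) om)
            oDown : down' o ≡ v
            oDown = ≔-hit _ o
            vLocal : Local G R.s' v (role' v)
            vLocal = withRole vFoot $
              hangsVia vUp (stillInside ho) oKnee (subst (λ p → adj G v p ≡ true) y≡o avy) ,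
              trans (cong down' vUp) oDown
            mLocal : Local G R.s' m (role' m)
            mLocal = withRole mCentre $
              twoLegs (roleDiff oF rC λ ()) (leg (stillInside ho) oUp (inj₂ oKnee))
                                            (leg (stillInside hr) K.rUp (inj₂ K.rKnee))
            oLocal : Local G R.s' o (role' o)
            oLocal = withRole oKnee $
              hangsVia oUp (stillInside hm) mCentre aom , footVia oDown vInside vFoot vUp

      viaLeg : ∀ {z} → SamePair y z m o → Grown
      viaLeg yz with otherLegs
      ... | twoMore a≢b la lb a≢m b≢m = moveLeg yz a≢b la lb a≢m b≢m
      ... | oneMore lw w≢m unique with Leg.legShape lw | yz
      ...   | inj₂ wK | _                  = OneMore.reroot lw w≢m unique yz wK
      ...   | inj₁ wL | inj₁ (y≡m , _)     = OneMore.WLeaf.atKnee lw w≢m unique wL y≡m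
      ...   | inj₁ wL | inj₂ (y≡o , _)     = OneMore.WLeaf.atFoot lw w≢m unique wL y≡o

    addVertex : Grown
    addVertex with role s y in ρ | I y hy
    ... | centre | _                 = attachLeaf ρ
    ... | leaf   | _                 = extendLeg ρ
    ... | knee   | _                 = OnLeg.viaLeg y hy ρ (inj₁ (refl , refl))
    ... | foot   | hangs hm mK _ , d = OnLeg.viaLeg (up s y) hm mK (inj₂ (sym d , refl))

  crossing : ∀ {P : Fin n → Set} → (∀ x → Dec (P x)) → ∀ {u w} → Walk G u w → P u → ¬ P w →
             Σ (Fin n) λ a → Σ (Fin n) λ b → P a × ¬ P b × (adj G a b ≡ true)
  crossing P? here pu ¬pw = ⊥-elim (¬pw pu)
  crossing P? (step {w = x} e rest) pu ¬pw with P? x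
  ... | yes px = crossing P? rest px ¬pw
  ... | no ¬px = _ , x , pu , ¬px , e

  star : ∀ {a b c} → a ≢ b → a ≢ c → b ≢ c → adj G a c ≡ true → adj G b c ≡ true →
         Σ (Spiders n) λ s → Valid G s × (inside s c ≡ true)
  star {a} {b} {c} a≢b a≢c b≢c aac abc = s , valid , cIn
    where
    s : Spiders n
    s = spiders (const false [ a ≔ true ] [ b ≔ true ] [ c ≔ true ]) (const leaf [ c ≔ centre ]) (const c) id
    cIn : inside s c ≡ true
    cIn = ≔-hit _ c
    bIn : inside s b ≡ true
    bIn = trans (≔-miss b≢c) (≔-hit _ b)
    aIn : inside s a ≡ true
    aIn = trans (≔-miss a≢c) (trans (≔-miss a≢b) (≔-hit _ a))
    valid : Valid G s
    valid x hx with x ≟ c | x ≟ a | x ≟ b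
    ... | yes refl | _ | _ =
      withRole (≔-hit _ c) (twoLegs a≢b (leg aIn refl (inj₁ (≔-miss a≢c))) (leg bIn refl (inj₁ (≔-miss b≢c))))
    ... | no x≢c | yes refl | _      = withRole (≔-miss x≢c) (hangsVia refl cIn (≔-hit _ c) aac)
    ... | no x≢c | no _     | yes refl = withRole (≔-miss x≢c) (hangsVia refl cIn (≔-hit _ c) abc)
    ... | no x≢c | no x≢a   | no x≢b
      with trans (sym hx) (trans (≔-miss x≢c) (trans (≔-miss x≢b) (≔-miss x≢a)))
    ...   | ()

  avoidTwo : ∀ {p q q'} → q ≢ p → q' ≢ p → q ≢ q' → ∀ a → Σ (Fin n) λ t → ¬ (t ≡ p ⊎ t ≡ a)
  avoidTwo {p} {q} {q'} q≢p q'≢p q≢q' a with a ≟ q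
  ... | yes refl = q' , [ q'≢p , (λ e → q≢q' (sym e)) ]
  ... | no a≢q   = q , [ q≢p , (λ e → a≢q (sym e)) ]

  seed : Connected G → ∀ {p q q'} → q ≢ p → q' ≢ p → q ≢ q' →
         Σ (Spiders n) λ s → Valid G s × ∃ λ z → inside s z ≡ true
  seed C {p} {q} {q'} q≢p q'≢p q≢q' with crossing (_≟ p) (C p q) refl q≢p
  ... | _ , a , refl , a≢p , apa with avoidTwo q≢p q'≢p q≢q' a
  ... | t , t∉ with crossing (λ x → (x ≟ p) ⊎-dec (x ≟ a)) (C p t) (inj₁ refl) t∉
  ...   | _ , c , inj₁ refl , c∉ , apc =
    let s , I , hp = star (λ e → c∉ (inj₂ (sym e))) a≢p (λ e → c∉ (inj₁ e)) (adjSym G apa) (adjSym G apc)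
    in s , I , p , hp
  ...   | _ , c , inj₂ refl , c∉ , aac =
    let s , I , ha = star (λ e → c∉ (inj₁ (sym e))) (λ e → a≢p (sym e)) (λ e → c∉ (inj₂ e)) apa (adjSym G aac)
    in s , I , a , ha

  uncovered : (Fin n → Bool) → ℕ
  uncovered b = ∑ (λ x → if b x then 0 else 1)

  fewerUncovered : ∀ (b : Fin n → Bool) v → b v ≡ false → uncovered (b [ v ≔ true ]) < uncovered b
  fewerUncovered b v bv =
    ∑-decrease _ _ v (λ x x≢v → cong count (≔-miss x≢v))
               (subst₂ _<_ (cong count (sym (≔-hit b v))) (cong count (sym bv)) (s≤s z≤n))
    where
    count : Bool → ℕ
    count β = if β then 0 else 1

  grow : Connected G → ∀ (s : Spiders n) → Valid G s → ∀ {z} → inside s z ≡ true →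
         Acc _<_ (uncovered (inside s)) → Σ (Spiders n) λ t → Valid G t × (∀ x → inside t x ≡ true)
  grow C s I {z} hz (acc smaller) with any? (λ x → inside s x Bool.≟ false)
  ... | no noneOut = s , I , λ x → Bool.¬-not (λ out → noneOut (x , out))
  ... | yes (x , out) with crossing (λ x → inside s x Bool.≟ true) (C z x) hz (Bool.not-¬ out)
  ...   | y , v , hy , ¬hv , ayv with Step.addVertex s I v y (Bool.¬-not ¬hv) hy (adjSym G ayv)
  ...     | t , It , eq =
    grow C t It (subst (λ b → b z ≡ true) (sym eq) (Step.stillInside s I v y hv hy (adjSym G ayv) hz))
           (smaller (subst (λ b → uncovered b < uncovered (inside s)) (sym eq)
                           (fewerUncovered (inside s) v hv)))
    where
    hv : inside s v ≡ false
    hv = Bool.¬-not ¬hv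

spiderCover : ∀ {n} (G : Graph n) → 3 ≤ n → Connected G →
              Σ (Spiders n) λ s → Valid G s × (∀ x → inside s x ≡ true)
spiderCover G (s≤s (s≤s (s≤s _))) C
  with Growth.seed G C {zero} {suc zero} {suc (suc zero)} (λ ()) (λ ()) (λ ())
... | s , I , z , hz = Growth.grow G C s I hz (<-wellFounded _)

corollary5 : ∀ (n : ℕ) (G : Graph n) → 3 ≤ n → Connected G →
    ∀ (a b : ℕ) → IsGammaR2 G a → IsGammaR G b →
    4 * (2 * a + b) ≤ 9 * n
corollary5 n G 3≤n C a b γr2 γR with spiderCover G 3≤n C
... | s , I , complete =
  boundByWitnesses G rainbow roman rainbowValid romanValid weightBound a b γr2 γR
  where open CompleteCover G s I complete
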